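{- For any integers $n,m$ with $1\leq n<m$, there exists a connected graph $G$ with $D(G)=n$ and $\dim(G)=m$.
   Context: For a connected graph $G$, a set $S\subseteq V(G)$ is resolving if every two distinct vertices of $G$ have different distances to some vertex of $S$; $\dim(G)$, the metric dimension, is the minimum size of a resolving set (metric dimension is defined for connected graphs). The distinguishing number $D(G)$ is the minimum number of colours in a (not necessarily proper) vertex colouring of $G$ such that the identity is the only automorphism of $G$ preserving the colouring. -}

module Defs where

open import Data.Nat using (ℕ; zero; suc; _≤_)
open import Data.Fin using (Fin)
open import Data.Fin.Subset using (Subset; _∈_; ∣_∣)
open import Data.Bool using (Bool; true; false)
open import Data.Product using (Σ; ∃; _×_; _,_)
open import Relation.Binary.PropositionalEquality using (_≡_; _≢_)
open import Relation.Nullary using (¬_)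

record Graph (k : ℕ) : Set where
  field
    adj     : Fin k → Fin k → Bool
    adj-sym : ∀ u v → adj u v ≡ adj v u
    adj-irr : ∀ u → adj u u ≡ false
open Graph public

Adj : ∀ {k} → Graph k → Fin k → Fin k → Set
Adj G u v = adj G u v ≡ true

data Walk {k} (G : Graph k) : Fin k → Fin k → ℕ → Set where
  here : ∀ {u} → Walk G u u zero
  step : ∀ {u v w ℓ} → Adj G u v → Walk G v w ℓ → Walk G u w (suc ℓ)

Connected : ∀ {k} → Graph k → Set
Connected G = ∀ u v → ∃ λ ℓ → Walk G u v ℓ

Dist : ∀ {k} → Graph k → Fin k → Fin k → ℕ → Set
Dist G u v d = Walk G u v d × (∀ ℓ → Walk G u v ℓ → d ≤ ℓ)

Resolving : ∀ {k} → Graph k → Subset k → Set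
Resolving G S = ∀ x y → x ≢ y →
  Σ _ λ s → s ∈ S × (∀ dx dy → Dist G x s dx → Dist G y s dy → dx ≢ dy)

MetricDim : ∀ {k} → Graph k → ℕ → Set
MetricDim G m =
  (Σ _ λ S → Resolving G S × ∣ S ∣ ≡ m) ×
  (∀ S → Resolving G S → m ≤ ∣ S ∣)

record Automorphism {k} (G : Graph k) : Set where
  field
    fun     : Fin k → Fin k
    inv     : Fin k → Fin k
    inv-l   : ∀ x → inv (fun x) ≡ x
    inv-r   : ∀ x → fun (inv x) ≡ x
    pres    : ∀ u v → adj G (fun u) (fun v) ≡ adj G u v
open Automorphism public

Distinguishing : ∀ {k r} → Graph k → (Fin k → Fin r) → Set
Distinguishing G c = ∀ (f : Automorphism G) →
  (∀ x → c (fun f x) ≡ c x) → ∀ x → fun f x ≡ x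

DistNum : ∀ {k} → Graph k → ℕ → Set
DistNum {k} G n =
  (Σ (Fin k → Fin n) λ c → Distinguishing G c) ×
  (∀ r (c : Fin k → Fin r) → Distinguishing G c → n ≤ r)

-- The witness is a spider: a centre with n pendant legs and m + 1 − n further legs of pairwise
-- distinct lengths ≥ 2. A resolving set must meet all legs but one, since otherwise the first nodes
-- of two empty legs have equal distances to it, while the first nodes of all legs but one do resolve;
-- hence dim = m. An automorphism fixes the centre (the only vertex of degree ≥ 3), so it preserves
-- depth and maps each tip to a tip of the same depth; it can therefore only permute the pendant
-- twins. Twins must get distinct colours, and giving the n twins distinct colours suffices.

module Submission where

open import Defs
open import Data.Nat.DivMod using (_%_; _mod_; m<n⇒m%n≡m)
open import Data.Nat using (ℕ; zero; suc; _+_; _∸_; _≤_; _<_; _⊔_; z≤n; s≤s; ∣_-_∣; _≡ᵇ_)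
import Data.Nat as ℕ
open import Data.Nat.Properties
  using (+-assoc; +-comm; +-identityʳ; +-mono-≤; +-monoʳ-≤; +-monoˡ-≤; 0≢1+n; 1+n≢0; 1+n≰n; <-cmp;
         <-irrefl; <-≤-trans; <⇒≢; <⇒≤; m+1+n≢0; m<n⇒0<n∸m; m∸n≡0⇒m≤n; m∸n≢0⇒n<m; m≢1+n+m; m≤m+n;
         m≤n+m; m≤n+∣n-m∣; m≤n⇒m∸n≡0; m≤n⇒m⊔n≡n; m≤∣m-n∣+n; m≥n⇒m⊔n≡m; m⊔n≤m+n; n≤0⇒n≡0; n≤1+n;
         suc-injective; ∣-∣-comm; ∣-∣-identityʳ; ∣-∣-triangle; ∣m-n∣≤m⊔n; ∣n-n∣≡0; ∸-cancelʳ-≡;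
         ≡ᵇ⇒≡; ≤-<-trans; ≤-antisym; ≤-pred; ≤-reflexive; ≤-trans; ≤∧≢⇒<; ≰⇒>; ⊔-idem; _≤?_;
         module ≤-Reasoning)
open import Data.Fin
  using (Fin; zero; suc; toℕ; _≟_; punchIn; splitAt; _↑ˡ_; _↑ʳ_; inject₁; inject≤; fromℕ; fromℕ<)
open import Data.Fin.Properties
  using (any?; injective⇒≤; punchIn-injective; punchInᵢ≢i;
         splitAt-↑ˡ; splitAt-↑ʳ; splitAt⁻¹-↑ˡ; splitAt⁻¹-↑ʳ; toℕ-injective; toℕ<n; toℕ-inject₁; toℕ-inject≤; toℕ-fromℕ; toℕ-fromℕ<; inject≤-injective)
import Data.Fin.Properties as Fin
open import Data.Fin.Permutation.Components using (transpose; transpose-inverse)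
open import Data.Fin.Subset using (Subset; _∈_; ∣_∣; _─_; ⁅_⁆)
open import Data.Fin.Subset.Properties
  using (_∈?_; ∣⊥∣≡0; x∈p∧x∉q⇒x∈p─q; x∈⁅y⁆⇒x≡y; x∈p⇒∣p-x∣<∣p∣)
open import Data.Vec using (sum; tabulate; replicate; _++_)
open import Data.Vec.Properties using (lookup⇒[]=; lookup-++ˡ; lookup-replicate)
open import Data.Bool using (Bool; true; false; T)
open import Data.Unit using (tt)
open import Data.Empty using (⊥; ⊥-elim)
open import Data.Product using (Σ; _×_; _,_; proj₁; proj₂)
open import Data.Sum using (_⊎_; inj₁; inj₂)
open import Relation.Binary.PropositionalEquality
open import Relation.Binary using (tri<; tri≈; tri>)
open import Relation.Nullary using (¬_; Dec; yes; no; does; ¬?; contradiction)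
open import Relation.Unary using (Decidable)
open import Relation.Nullary.Decidable using (decidable-stable; dec-true; dec-false)
open import Function using (_∘_)
open import Function.Definitions using (Injective)

module _ {k} {G : Graph k} where

  invert : Automorphism G → Automorphism G
  invert f = record
    { fun = inv f ; inv = fun f ; inv-l = inv-r f ; inv-r = inv-l f
    ; pres = λ u v → trans (sym (pres f (inv f u) (inv f v)))
                           (cong₂ (adj G) (inv-r f u) (inv-r f v)) }

  mapʷ : (f : Automorphism G) → ∀ {u v ℓ} → Walk G u v ℓ → Walk G (fun f u) (fun f v) ℓ
  mapʷ f here = here
  mapʷ f (step {u = u} {v = v} e w) = step (trans (pres f u v) e) (mapʷ f w)

  Dist-unique : ∀ {x y d d′} → Dist G x y d → Dist G x y d′ → d ≡ d′
  Dist-unique (w , min) (w′ , min′) = ≤-antisym (min _ w′) (min′ _ w)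

  Dist-automorphism : (f : Automorphism G) → ∀ {x y d} →
    Dist G x y d → Dist G (fun f x) (fun f y) d
  Dist-automorphism f {x} {y} (w , min) = mapʷ f w , λ ℓ w′ →
    min ℓ (subst₂ (λ a b → Walk G a b ℓ) (inv-l f x) (inv-l f y) (mapʷ (invert f) w′))

module Twins {k} (G : Graph k) {u v : Fin k} (u≢v : u ≢ v)
  (twin : ∀ w → w ≢ u → w ≢ v → adj G u w ≡ adj G v w) where

  private
    τ : Fin k → Fin k
    τ = transpose u v

    data Swapped : Fin k → Fin k → Set where
      u↦v : Swapped u v
      v↦u : Swapped v u
      fixed : ∀ {w} → w ≢ u → w ≢ v → Swapped w w

    swapped : ∀ x → Swapped x (τ x)
    swapped x with x ≟ u
    ... | yes refl = u↦v
    ... | no x≢u with x ≟ v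
    ...   | yes refl = v↦u
    ...   | no x≢v = fixed x≢u x≢v

    twinˡ : ∀ w → w ≢ u → w ≢ v → adj G w v ≡ adj G w u
    twinˡ w w≢u w≢v = trans (adj-sym G w v) (trans (sym (twin w w≢u w≢v)) (adj-sym G u w))

    τ-preserves-adj : ∀ x y → adj G (τ x) (τ y) ≡ adj G x y
    τ-preserves-adj x y with τ x | swapped x | τ y | swapped y
    ... | ._ | u↦v | ._ | u↦v = trans (adj-irr G v) (sym (adj-irr G u))
    ... | ._ | u↦v | ._ | v↦u = adj-sym G v u
    ... | ._ | u↦v | ._ | fixed y≢u y≢v = sym (twin y y≢u y≢v)
    ... | ._ | v↦u | ._ | u↦v = adj-sym G u v
    ... | ._ | v↦u | ._ | v↦u = trans (adj-irr G u) (sym (adj-irr G v))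
    ... | ._ | v↦u | ._ | fixed y≢u y≢v = twin y y≢u y≢v
    ... | ._ | fixed x≢u x≢v | ._ | u↦v = twinˡ x x≢u x≢v
    ... | ._ | fixed x≢u x≢v | ._ | v↦u = sym (twinˡ x x≢u x≢v)
    ... | ._ | fixed _ _ | ._ | fixed _ _ = refl

    τ-u : τ u ≡ v
    τ-u with τ u | swapped u
    ... | _ | u↦v = refl
    ... | _ | v↦u = refl
    ... | _ | fixed u≢u _ = contradiction refl u≢u

  swap : Automorphism G
  swap = record
    { fun = τ ; inv = transpose v u ; pres = τ-preserves-adj
    ; inv-l = λ _ → transpose-inverse v u ; inv-r = λ _ → transpose-inverse u v }

  distinguishing⇒colours-differ : ∀ {r} (c : Fin k → Fin r) →
    Distinguishing G c → c u ≢ c v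
  distinguishing⇒colours-differ c dist cu≡cv = u≢v (trans (sym (dist swap c∘τ u)) τ-u)
    where
    c∘τ : ∀ x → c (τ x) ≡ c x
    c∘τ x with τ x | swapped x
    ... | _ | u↦v = sym cu≡cv
    ... | _ | v↦u = cu≡cv
    ... | _ | fixed _ _ = refl

injective⇒≤∣p∣ : ∀ {k a} (p : Subset k) (g : Fin a → Fin k) →
  Injective _≡_ _≡_ g → (∀ i → g i ∈ p) → a ≤ ∣ p ∣
injective⇒≤∣p∣ {a = zero} p g inj g∈p = z≤n
injective⇒≤∣p∣ {a = suc a} p g inj g∈p =
  ≤-<-trans (injective⇒≤∣p∣ (p ─ ⁅ g zero ⁆) (g ∘ suc) (Fin.suc-injective ∘ inj) g∘suc∈p─g0)
            (x∈p⇒∣p-x∣<∣p∣ (g∈p zero))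
  where
  g∘suc∈p─g0 : ∀ i → g (suc i) ∈ p ─ ⁅ g zero ⁆
  g∘suc∈p─g0 i = x∈p∧x∉q⇒x∈p─q (g∈p (suc i)) λ gi∈⁅g0⁆ →
    Fin.0≢1+n (inj (sym (x∈⁅y⁆⇒x≡y _ gi∈⁅g0⁆)))

all-but-one : ∀ {a} {P : Fin (suc a) → Set} → Decidable P → (∀ i j → i ≢ j → P i ⊎ P j) →
  Σ (Fin a → Fin (suc a)) λ h → Injective _≡_ _≡_ h × (∀ i → P (h i))
all-but-one {P = P} P? P-pairwise with any? (¬? ∘ P?)
... | yes (i₀ , ¬Pi₀) = punchIn i₀ , punchIn-injective i₀ _ _ , P∘punchIn
  where
  P∘punchIn : ∀ i → P (punchIn i₀ i)
  P∘punchIn i with P-pairwise i₀ (punchIn i₀ i) (punchInᵢ≢i i₀ i ∘ sym)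
  ... | inj₁ Pi₀ = contradiction Pi₀ ¬Pi₀
  ... | inj₂ Pi = Pi
... | no ∄¬P = suc , Fin.suc-injective , λ i →
  decidable-stable (P? (suc i)) (λ ¬Pi → ∄¬P (suc i , ¬Pi))

toΣ : ∀ {a} (e : Fin a → ℕ) → Fin (sum (tabulate e)) → Σ (Fin a) (Fin ∘ e)
toΣ {suc a} e x with splitAt (e zero) x
... | inj₁ t = zero , t
... | inj₂ y with toΣ (e ∘ suc) y
...   | i , t = suc i , t

fromΣ : ∀ {a} (e : Fin a → ℕ) → Σ (Fin a) (Fin ∘ e) → Fin (sum (tabulate e))
fromΣ {suc a} e (zero , t) = t ↑ˡ sum (tabulate (e ∘ suc))
fromΣ {suc a} e (suc i , t) = e zero ↑ʳ fromΣ (e ∘ suc) (i , t)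

toΣ-fromΣ : ∀ {a} (e : Fin a → ℕ) it → toΣ e (fromΣ e it) ≡ it
toΣ-fromΣ {suc a} e (zero , t) rewrite splitAt-↑ˡ (e zero) t (sum (tabulate (e ∘ suc))) = refl
toΣ-fromΣ {suc a} e (suc i , t)
  rewrite splitAt-↑ʳ (e zero) (sum (tabulate (e ∘ suc))) (fromΣ (e ∘ suc) (i , t))
        | toΣ-fromΣ (e ∘ suc) (i , t) = refl

fromΣ-toΣ : ∀ {a} (e : Fin a → ℕ) x → fromΣ e (toΣ e x) ≡ x
fromΣ-toΣ {suc a} e x with splitAt (e zero) x in split≡
... | inj₁ t = splitAt⁻¹-↑ˡ split≡
... | inj₂ y with toΣ (e ∘ suc) y | fromΣ-toΣ (e ∘ suc) y
...   | i , t | fromΣ-y≡y = trans (cong (e zero ↑ʳ_) fromΣ-y≡y) (splitAt⁻¹-↑ʳ split≡)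

GeodesicStep : ∀ {V : Set} → (V → V → ℕ) → V → V → Set
GeodesicStep {V} δ X Y = X ≡ Y ⊎ Σ V λ Z → δ X Z ≡ 1 × suc (δ Z Y) ≡ δ X Y

-- A distance function on a type V in bijection with Fin k, in which every distance is realised by
-- a chain of unit steps, is the shortest-path distance of the graph whose edges are its unit steps.
module PathMetric {k} {V : Set} (enc : V → Fin k) (dec : Fin k → V)
  (dec∘enc : ∀ X → dec (enc X) ≡ X) (enc∘dec : ∀ x → enc (dec x) ≡ x)
  (δ : V → V → ℕ) (δ-self : ∀ X → δ X X ≡ 0) (δ-sym : ∀ X Y → δ X Y ≡ δ Y X)
  (δ-triangle : ∀ X Y Z → δ X Z ≤ δ X Y + δ Y Z)
  (geodesic-step : ∀ X Y → GeodesicStep δ X Y) where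

  graph : Graph k
  graph = record
    { adj = λ x y → δ (dec x) (dec y) ≡ᵇ 1
    ; adj-sym = λ x y → cong (_≡ᵇ 1) (δ-sym (dec x) (dec y))
    ; adj-irr = λ x → cong (_≡ᵇ 1) (δ-self (dec x)) }

  enc-injective : Injective _≡_ _≡_ enc
  enc-injective {X} {Y} e = trans (sym (dec∘enc X)) (trans (cong dec e) (dec∘enc Y))

  dec-injective : Injective _≡_ _≡_ dec
  dec-injective {x} {y} e = trans (sym (enc∘dec x)) (trans (cong enc e) (enc∘dec y))

  Adj⇒δ≡1 : ∀ {x y} → Adj graph x y → δ (dec x) (dec y) ≡ 1
  Adj⇒δ≡1 {x} {y} e = ≡ᵇ⇒≡ (δ (dec x) (dec y)) 1 (subst T (sym e) tt)

  δ≡1⇒Adj : ∀ {X Y} → δ X Y ≡ 1 → Adj graph (enc X) (enc Y)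
  δ≡1⇒Adj {X} {Y} e rewrite dec∘enc X | dec∘enc Y | e = refl

  walk⇒δ≤ : ∀ {x y ℓ} → Walk graph x y ℓ → δ (dec x) (dec y) ≤ ℓ
  walk⇒δ≤ {x} here = ≤-reflexive (δ-self (dec x))
  walk⇒δ≤ {x} {z} (step {v = y} {ℓ = ℓ} e w) = begin
    δ (dec x) (dec z)                     ≤⟨ δ-triangle (dec x) (dec y) (dec z) ⟩
    δ (dec x) (dec y) + δ (dec y) (dec z) ≡⟨ cong (_+ δ (dec y) (dec z)) (Adj⇒δ≡1 e) ⟩
    suc (δ (dec y) (dec z))               ≤⟨ s≤s (walk⇒δ≤ w) ⟩
    suc ℓ                                 ∎
    where open ≤-Reasoning

  geodesic : ∀ n X Y → δ X Y ≡ n → Walk graph (enc X) (enc Y) n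
  geodesic n X Y δ≡n with geodesic-step X Y
  geodesic zero X .X _ | inj₁ refl = here
  geodesic (suc n) X .X δ≡n | inj₁ refl = contradiction (trans (sym (δ-self X)) δ≡n) 0≢1+n
  geodesic zero X Y δ≡0 | inj₂ (_ , _ , 1+δ≡δ) = contradiction (trans 1+δ≡δ δ≡0) 1+n≢0
  geodesic (suc n) X Y δ≡n | inj₂ (Z , δXZ≡1 , 1+δ≡δ) =
    step (δ≡1⇒Adj δXZ≡1) (geodesic n Z Y (suc-injective (trans 1+δ≡δ δ≡n)))

  dist : ∀ x y → Dist graph x y (δ (dec x) (dec y))
  dist x y =
    subst₂ (λ a b → Walk graph a b _) (enc∘dec x) (enc∘dec y) (geodesic _ (dec x) (dec y) refl) ,
    λ _ → walk⇒δ≤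

  distᵛ : ∀ X y → Dist graph (enc X) y (δ X (dec y))
  distᵛ X y = subst (λ Z → Dist graph (enc X) y (δ Z (dec y))) (dec∘enc X) (dist (enc X) y)

  Dist⇒≡δ : ∀ {x y d} → Dist graph x y d → d ≡ δ (dec x) (dec y)
  Dist⇒≡δ {x} {y} D = Dist-unique D (dist x y)

  connected : Connected graph
  connected x y = _ , proj₁ (dist x y)

  Separates : Subset k → V → V → Set
  Separates S X Y = Σ (Fin k) λ s → s ∈ S × δ X (dec s) ≢ δ Y (dec s)

  separating⇒resolving : ∀ S → (∀ X Y → X ≢ Y → Separates S X Y) → Resolving graph S
  separating⇒resolving S separate x y x≢y with separate (dec x) (dec y) (x≢y ∘ dec-injective)
  ... | s , s∈S , δ≢δ = s , s∈S , λ dx dy Dx Dy dx≡dy →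
    δ≢δ (trans (sym (Dist⇒≡δ Dx)) (trans dx≡dy (Dist⇒≡δ Dy)))

  resolving⇒separating : ∀ S → Resolving graph S → ∀ X Y → X ≢ Y → Separates S X Y
  resolving⇒separating S resolve X Y X≢Y with resolve (enc X) (enc Y) (X≢Y ∘ enc-injective)
  ... | s , s∈S , separated = s , s∈S , separated _ _ (distᵛ X s) (distᵛ Y s)

  onV : Automorphism graph → V → V
  onV f X = dec (fun f (enc X))

  onV-isometry : ∀ f X Y → δ (onV f X) (onV f Y) ≡ δ X Y
  onV-isometry f X Y = sym (trans (sym (cong₂ δ (dec∘enc X) (dec∘enc Y)))
                                  (Dist⇒≡δ (Dist-automorphism f (dist (enc X) (enc Y)))))

  onV-inverse : ∀ f X → onV f (onV (invert f) X) ≡ X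
  onV-inverse f X = begin
    dec (fun f (enc (dec (inv f (enc X))))) ≡⟨ cong (dec ∘ fun f) (enc∘dec (inv f (enc X))) ⟩
    dec (fun f (inv f (enc X)))             ≡⟨ cong dec (inv-r f (enc X)) ⟩
    dec (enc X)                             ≡⟨ dec∘enc X ⟩
    X                                       ∎
    where open ≡-Reasoning

  onV-identity⇒identity : ∀ f → (∀ X → onV f X ≡ X) → ∀ x → fun f x ≡ x
  onV-identity⇒identity f fixes x = begin
    fun f x             ≡⟨ sym (enc∘dec (fun f x)) ⟩
    enc (dec (fun f x)) ≡⟨ cong (enc ∘ dec ∘ fun f) (sym (enc∘dec x)) ⟩
    enc (onV f (dec x)) ≡⟨ cong enc (fixes (dec x)) ⟩
    enc (dec x)         ≡⟨ enc∘dec x ⟩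
    x                   ∎
    where open ≡-Reasoning

  dec≡⇒≡enc : ∀ {x X} → dec x ≡ X → x ≡ enc X
  dec≡⇒≡enc {x} refl = sym (enc∘dec x)

  twins⇒colours-differ : ∀ {X Y} → X ≢ Y → (∀ W → W ≢ X → W ≢ Y → δ X W ≡ δ Y W) →
    ∀ {r} (c : Fin k → Fin r) → Distinguishing graph c → c (enc X) ≢ c (enc Y)
  twins⇒colours-differ {X} {Y} X≢Y twins = distinguishing⇒colours-differ
    where
    adj-twins : ∀ w → w ≢ enc X → w ≢ enc Y → adj graph (enc X) w ≡ adj graph (enc Y) w
    adj-twins w w≢X w≢Y = cong (_≡ᵇ 1) (begin
      δ (dec (enc X)) (dec w) ≡⟨ cong (λ Z → δ Z (dec w)) (dec∘enc X) ⟩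
      δ X (dec w)             ≡⟨ twins (dec w) (w≢X ∘ dec≡⇒≡enc) (w≢Y ∘ dec≡⇒≡enc) ⟩
      δ Y (dec w)             ≡⟨ cong (λ Z → δ Z (dec w)) (sym (dec∘enc Y)) ⟩
      δ (dec (enc Y)) (dec w) ∎)
      where open ≡-Reasoning
    open Twins graph (X≢Y ∘ enc-injective) adj-twins

two-of-three : ∀ {A : Set} {a b x y z : A} →
  x ≡ a ⊎ x ≡ b → y ≡ a ⊎ y ≡ b → z ≡ a ⊎ z ≡ b → x ≡ y ⊎ x ≡ z ⊎ y ≡ z
two-of-three (inj₁ x≡a) (inj₁ y≡a) _ = inj₁ (trans x≡a (sym y≡a))
two-of-three (inj₂ x≡b) (inj₂ y≡b) _ = inj₁ (trans x≡b (sym y≡b))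
two-of-three (inj₁ x≡a) (inj₂ _) (inj₁ z≡a) = inj₂ (inj₁ (trans x≡a (sym z≡a)))
two-of-three (inj₂ x≡b) (inj₁ _) (inj₂ z≡b) = inj₂ (inj₁ (trans x≡b (sym z≡b)))
two-of-three (inj₁ _) (inj₂ y≡b) (inj₂ z≡b) = inj₂ (inj₂ (trans y≡b (sym z≡b)))
two-of-three (inj₂ _) (inj₁ y≡a) (inj₁ z≡a) = inj₂ (inj₂ (trans y≡a (sym z≡a)))

-- Distance between points at heights a and b of a rooted tree, lying on the same branch iff s.
branchDist : Bool → ℕ → ℕ → ℕ
branchDist true a b = ∣ a - b ∣
branchDist false a b = a + b

branchDist-sym : ∀ s a b → branchDist s a b ≡ branchDist s b a
branchDist-sym true a b = ∣-∣-comm a b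
branchDist-sym false a b = +-comm a b

branchDist-triangle : ∀ s₁ s₂ s₃ a b c →
  (T s₁ → T s₂ → T s₃) → (T s₁ → T s₃ → T s₂) → (T s₂ → T s₃ → T s₁) →
  branchDist s₃ a c ≤ branchDist s₁ a b + branchDist s₂ b c
branchDist-triangle true true true a b c _ _ _ = ∣-∣-triangle a b c
branchDist-triangle true true false a b c s₃ _ _ = ⊥-elim (s₃ tt tt)
branchDist-triangle true false true a b c _ s₂ _ = ⊥-elim (s₂ tt tt)
branchDist-triangle false true true a b c _ _ s₁ = ⊥-elim (s₁ tt tt)
branchDist-triangle true false false a b c _ _ _ =
  subst (a + c ≤_) (+-assoc ∣ a - b ∣ b c) (+-monoˡ-≤ c (m≤∣m-n∣+n a b))
branchDist-triangle false true false a b c _ _ _ =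
  subst (a + c ≤_) (sym (+-assoc a b ∣ b - c ∣)) (+-monoʳ-≤ a (m≤n+∣n-m∣ c b))
branchDist-triangle false false true a b c _ _ _ =
  ≤-trans (∣m-n∣≤m⊔n a c) (≤-trans (m⊔n≤m+n a c) (+-mono-≤ (m≤m+n a b) (m≤n+m c b)))
branchDist-triangle false false false a b c _ _ _ = +-mono-≤ (m≤m+n a b) (m≤n+m c b)

∣n-1+n∣≡1 : ∀ n → ∣ n - suc n ∣ ≡ 1
∣n-1+n∣≡1 zero = refl
∣n-1+n∣≡1 (suc n) = ∣n-1+n∣≡1 n

∣m-n∣≡1⇒adjacent : ∀ {m n} → ∣ m - n ∣ ≡ 1 → suc n ≡ m ⊎ n ≡ suc m
∣m-n∣≡1⇒adjacent {zero} {suc zero} _ = inj₂ refl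
∣m-n∣≡1⇒adjacent {suc zero} {zero} _ = inj₁ refl
∣m-n∣≡1⇒adjacent {suc m} {suc n} e with ∣m-n∣≡1⇒adjacent {m} {n} e
... | inj₁ 1+n≡m = inj₁ (cong suc 1+n≡m)
... | inj₂ n≡1+m = inj₂ (cong suc n≡1+m)

suc∣1+m-n∣≡∣m-n∣ : ∀ {m n} → m < n → suc ∣ suc m - n ∣ ≡ ∣ m - n ∣
suc∣1+m-n∣≡∣m-n∣ {zero} {suc n} _ = refl
suc∣1+m-n∣≡∣m-n∣ {suc m} {suc n} (s≤s m<n) = suc∣1+m-n∣≡∣m-n∣ m<n

suc∣m-n∣≡∣1+m-n∣ : ∀ {m n} → n ≤ m → suc ∣ m - n ∣ ≡ ∣ suc m - n ∣
suc∣m-n∣≡∣1+m-n∣ {zero} {zero} _ = refl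
suc∣m-n∣≡∣1+m-n∣ {suc m} {zero} _ = refl
suc∣m-n∣≡∣1+m-n∣ {suc m} {suc n} (s≤s n≤m) = suc∣m-n∣≡∣1+m-n∣ n≤m

∸-%-injective : ∀ {a b p} → a ∸ p ≡ b ∸ p → a % suc p ≡ b % suc p → a ≡ b
∸-%-injective {a} {b} {p} ∸≡ %≡ with a ≤? p
... | yes a≤p = trans (sym (m<n⇒m%n≡m (s≤s a≤p))) (trans %≡ (m<n⇒m%n≡m (s≤s b≤p)))
  where
  b≤p : b ≤ p
  b≤p = m∸n≡0⇒m≤n (trans (sym ∸≡) (m≤n⇒m∸n≡0 a≤p))
... | no a≰p = ∸-cancelʳ-≡ (<⇒≤ p<a) (<⇒≤ p<b) ∸≡
  where
  p<a : p < a
  p<a = ≰⇒> a≰p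
  p<b : p < b
  p<b = m∸n≢0⇒n<m λ b∸p≡0 → <⇒≢ (m<n⇒0<n∸m p<a) (sym (trans ∸≡ b∸p≡0))

-- A centre with legs indexed by Fin (3 + M′); leg i carries the nodes of depth 1 … top i + 1,
-- so the legs 0 … p are pendant twins and the remaining legs have distinct lengths.
module Spider (p M′ : ℕ) where

  M : ℕ
  M = suc (suc M′)

  Leg : Set
  Leg = Fin (suc M)

  top : Leg → ℕ
  top i = toℕ i ∸ p

  data Vertex : Set where
    centre : Vertex
    node : (i : Leg) → Fin (suc (top i)) → Vertex

  depth : Vertex → ℕ
  depth centre = 0
  depth (node i t) = suc (toℕ t)

  sameLeg : Vertex → Vertex → Bool
  sameLeg (node i _) (node j _) = does (i ≟ j)
  sameLeg _ _ = false

  δ : Vertex → Vertex → ℕ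
  δ X Y = branchDist (sameLeg X Y) (depth X) (depth Y)

  δ-same-leg : ∀ i t u → δ (node i t) (node i u) ≡ ∣ toℕ t - toℕ u ∣
  δ-same-leg i t u rewrite dec-true (i ≟ i) refl = refl

  δ-other-leg : ∀ {i j} → i ≢ j → ∀ t u →
    δ (node i t) (node j u) ≡ suc (toℕ t) + suc (toℕ u)
  δ-other-leg {i} {j} i≢j t u rewrite dec-false (i ≟ j) i≢j = refl

  δ-centreʳ : ∀ X → δ X centre ≡ depth X
  δ-centreʳ centre = refl
  δ-centreʳ (node i t) = +-identityʳ _

  δ-self : ∀ X → δ X X ≡ 0
  δ-self centre = refl
  δ-self (node i t) = trans (δ-same-leg i t t) (∣n-n∣≡0 (toℕ t))

  sameLeg-sym : ∀ X Y → sameLeg X Y ≡ sameLeg Y X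
  sameLeg-sym centre centre = refl
  sameLeg-sym centre (node _ _) = refl
  sameLeg-sym (node _ _) centre = refl
  sameLeg-sym (node i _) (node j _) with i ≟ j | j ≟ i
  ... | yes _ | yes _ = refl
  ... | no _ | no _ = refl
  ... | yes i≡j | no j≢i = contradiction (sym i≡j) j≢i
  ... | no i≢j | yes j≡i = contradiction (sym j≡i) i≢j

  sameLeg-trans : ∀ X Y Z → T (sameLeg X Y) → T (sameLeg Y Z) → T (sameLeg X Z)
  sameLeg-trans (node i _) (node j _) (node l _) i∼j j∼l with i ≟ j | j ≟ l
  ... | yes refl | yes refl = subst T (sym (dec-true (i ≟ i) refl)) tt

  δ-sym : ∀ X Y → δ X Y ≡ δ Y X
  δ-sym X Y = trans (branchDist-sym (sameLeg X Y) (depth X) (depth Y))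
                    (cong (λ s → branchDist s (depth Y) (depth X)) (sameLeg-sym X Y))

  δ-triangle : ∀ X Y Z → δ X Z ≤ δ X Y + δ Y Z
  δ-triangle X Y Z = branchDist-triangle (sameLeg X Y) (sameLeg Y Z) (sameLeg X Z)
    (depth X) (depth Y) (depth Z)
    (sameLeg-trans X Y Z)
    (λ XY XZ → sameLeg-trans Y X Z (subst T (sameLeg-sym X Y) XY) XZ)
    (λ YZ XZ → sameLeg-trans X Z Y XZ (subst T (sameLeg-sym Y Z) YZ))

  down : (i : Leg) → Fin (suc (top i)) → Vertex
  down i zero = centre
  down i (suc t) = node i (inject₁ t)

  up : (i : Leg) (t : Fin (suc (top i))) → toℕ t < top i → Vertex
  up i t t<top = node i (fromℕ< (s≤s t<top))

  depth-down : ∀ i t → depth (down i t) ≡ toℕ t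
  depth-down i zero = refl
  depth-down i (suc t) = cong suc (toℕ-inject₁ t)

  depth-up : ∀ i t t<top → depth (up i t t<top) ≡ suc (suc (toℕ t))
  depth-up i t t<top = cong suc (toℕ-fromℕ< (s≤s t<top))

  δ-down : ∀ i t → δ (node i t) (down i t) ≡ 1
  δ-down i zero = refl
  δ-down i (suc t) = begin
    δ (node i (suc t)) (node i (inject₁ t)) ≡⟨ δ-same-leg i (suc t) (inject₁ t) ⟩
    ∣ suc (toℕ t) - toℕ (inject₁ t) ∣       ≡⟨ cong (∣ suc (toℕ t) -_∣) (toℕ-inject₁ t) ⟩
    ∣ suc (toℕ t) - toℕ t ∣                 ≡⟨ ∣-∣-comm (suc (toℕ t)) (toℕ t) ⟩
    ∣ toℕ t - suc (toℕ t) ∣                 ≡⟨ ∣n-1+n∣≡1 (toℕ t) ⟩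
    1                                       ∎
    where open ≡-Reasoning

  δ-up : ∀ i t t<top → δ (node i t) (up i t t<top) ≡ 1
  δ-up i t t<top = begin
    δ (node i t) (up i t t<top)          ≡⟨ δ-same-leg i t _ ⟩
    ∣ toℕ t - toℕ (fromℕ< (s≤s t<top)) ∣ ≡⟨ cong (∣ toℕ t -_∣) (toℕ-fromℕ< (s≤s t<top)) ⟩
    ∣ toℕ t - suc (toℕ t) ∣              ≡⟨ ∣n-1+n∣≡1 (toℕ t) ⟩
    1                                    ∎
    where open ≡-Reasoning

  down-towards-centre : ∀ i t → suc (δ (down i t) centre) ≡ δ (node i t) centre
  down-towards-centre i t = begin
    suc (δ (down i t) centre) ≡⟨ cong suc (trans (δ-centreʳ (down i t)) (depth-down i t)) ⟩
    depth (node i t)          ≡⟨ sym (δ-centreʳ (node i t)) ⟩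
    δ (node i t) centre       ∎
    where open ≡-Reasoning

  down-towards-other-leg : ∀ {i j} → i ≢ j → ∀ t u →
    suc (δ (down i t) (node j u)) ≡ δ (node i t) (node j u)
  down-towards-other-leg i≢j zero u = sym (δ-other-leg i≢j zero u)
  down-towards-other-leg i≢j (suc t) u = begin
    suc (δ (node _ (inject₁ t)) (node _ u))   ≡⟨ cong suc (δ-other-leg i≢j (inject₁ t) u) ⟩
    suc (suc (toℕ (inject₁ t)) + suc (toℕ u)) ≡⟨ cong (λ a → suc (suc a + suc (toℕ u))) (toℕ-inject₁ t) ⟩
    suc (suc (toℕ t)) + suc (toℕ u)           ≡⟨ sym (δ-other-leg i≢j (suc t) u) ⟩
    δ (node _ (suc t)) (node _ u)             ∎
    where open ≡-Reasoning

  down-towards-below : ∀ i t u → toℕ u < toℕ t →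
    suc (δ (down i t) (node i u)) ≡ δ (node i t) (node i u)
  down-towards-below i (suc t) u (s≤s u≤t) = begin
    suc (δ (node i (inject₁ t)) (node i u)) ≡⟨ cong suc (δ-same-leg i (inject₁ t) u) ⟩
    suc ∣ toℕ (inject₁ t) - toℕ u ∣         ≡⟨ cong (λ a → suc ∣ a - toℕ u ∣) (toℕ-inject₁ t) ⟩
    suc ∣ toℕ t - toℕ u ∣                   ≡⟨ suc∣m-n∣≡∣1+m-n∣ u≤t ⟩
    ∣ suc (toℕ t) - toℕ u ∣                 ≡⟨ sym (δ-same-leg i (suc t) u) ⟩
    δ (node i (suc t)) (node i u)           ∎
    where open ≡-Reasoning

  up-towards-above : ∀ i t u t<top → toℕ t < toℕ u →
    suc (δ (up i t t<top) (node i u)) ≡ δ (node i t) (node i u)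
  up-towards-above i t u t<top t<u = begin
    suc (δ (up i t t<top) (node i u))        ≡⟨ cong suc (δ-same-leg i _ u) ⟩
    suc ∣ toℕ (fromℕ< (s≤s t<top)) - toℕ u ∣ ≡⟨ cong (λ a → suc ∣ a - toℕ u ∣) (toℕ-fromℕ< (s≤s t<top)) ⟩
    suc ∣ suc (toℕ t) - toℕ u ∣              ≡⟨ suc∣1+m-n∣≡∣m-n∣ t<u ⟩
    ∣ toℕ t - toℕ u ∣                        ≡⟨ sym (δ-same-leg i t u) ⟩
    δ (node i t) (node i u)                  ∎
    where open ≡-Reasoning

  geodesic-step-nodes : ∀ i t j u → Dec (i ≡ j) → GeodesicStep δ (node i t) (node j u)
  geodesic-step-nodes i t j u (no i≢j) =
    inj₂ (down i t , δ-down i t , down-towards-other-leg i≢j t u)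
  geodesic-step-nodes i t i u (yes refl) with <-cmp (toℕ t) (toℕ u)
  ... | tri≈ _ t≡u _ = inj₁ (cong (node i) (toℕ-injective t≡u))
  ... | tri> _ _ u<t = inj₂ (down i t , δ-down i t , down-towards-below i t u u<t)
  ... | tri< t<u _ _ = inj₂ (up i t t<top , δ-up i t t<top , up-towards-above i t u t<top t<u)
    where
    t<top : toℕ t < top i
    t<top = <-≤-trans t<u (≤-pred (toℕ<n u))

  geodesic-step : ∀ X Y → GeodesicStep δ X Y
  geodesic-step centre centre = inj₁ refl
  geodesic-step centre (node j u) = inj₂ (node j zero , refl , cong suc (δ-same-leg j zero u))
  geodesic-step (node i t) centre = inj₂ (down i t , δ-down i t , down-towards-centre i t)
  geodesic-step (node i t) (node j u) = geodesic-step-nodes i t j u (i ≟ j)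

  -- The first nodes of legs 1 … M are numbered first, so that these landmarks form a prefix.
  rest : ℕ
  rest = suc (suc (sum (tabulate top)))

  k : ℕ
  k = M + rest

  enc : Vertex → Fin k
  enc centre = M ↑ʳ zero
  enc (node i (suc t)) = M ↑ʳ suc (suc (fromΣ top (i , t)))
  enc (node zero zero) = M ↑ʳ suc zero
  enc (node (suc j) zero) = j ↑ˡ rest

  dec : Fin k → Vertex
  dec x with splitAt M x
  ... | inj₁ j = node (suc j) zero
  ... | inj₂ zero = centre
  ... | inj₂ (suc zero) = node zero zero
  ... | inj₂ (suc (suc z)) = node (proj₁ (toΣ top z)) (suc (proj₂ (toΣ top z)))

  dec∘enc : ∀ X → dec (enc X) ≡ X
  dec∘enc centre rewrite splitAt-↑ʳ M rest zero = refl
  dec∘enc (node zero zero) rewrite splitAt-↑ʳ M rest (suc zero) = refl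
  dec∘enc (node (suc j) zero) rewrite splitAt-↑ˡ M j rest = refl
  dec∘enc (node i (suc t))
    rewrite splitAt-↑ʳ M rest (suc (suc (fromΣ top (i , t)))) | toΣ-fromΣ top (i , t) = refl

  enc∘dec : ∀ x → enc (dec x) ≡ x
  enc∘dec x with splitAt M x in split≡
  ... | inj₁ j = splitAt⁻¹-↑ˡ split≡
  ... | inj₂ zero = splitAt⁻¹-↑ʳ split≡
  ... | inj₂ (suc zero) = splitAt⁻¹-↑ʳ split≡
  ... | inj₂ (suc (suc z)) =
    trans (cong (λ w → M ↑ʳ suc (suc w)) (fromΣ-toΣ top z)) (splitAt⁻¹-↑ʳ split≡)

  open PathMetric enc dec dec∘enc enc∘dec δ δ-self δ-sym δ-triangle geodesic-step public

  first : Leg → Vertex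
  first l = node l zero

  node-leg-injective : ∀ {i j t u} → node i t ≡ node j u → i ≡ j
  node-leg-injective refl = refl

  data LegView (l : Leg) : Vertex → Set where
    on : ∀ t → LegView l (node l t)
    off : ∀ {Y} → (∀ u → Y ≢ node l u) → LegView l Y

  legView : ∀ l Y → LegView l Y
  legView l centre = off λ _ ()
  legView l (node j u) with j ≟ l
  ... | yes refl = on u
  ... | no j≢l = off λ { _ refl → j≢l refl }

  δ-first-on : ∀ l t → δ (node l t) (first l) ≡ toℕ t
  δ-first-on l t = trans (δ-same-leg l t zero) (∣-∣-identityʳ (toℕ t))

  δ-off-leg : ∀ {l} Y → (∀ u → Y ≢ node l u) → ∀ s →
    δ Y (node l s) ≡ depth Y + suc (toℕ s)
  δ-off-leg centre _ s = refl
  δ-off-leg (node j u) off-l s = δ-other-leg (λ { refl → off-l u refl }) u s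

  δ-first-off : ∀ {l} Y → (∀ u → Y ≢ node l u) → δ Y (first l) ≡ suc (depth Y)
  δ-first-off Y off-l = trans (δ-off-leg Y off-l zero) (+-comm (depth Y) 1)

  -- X is at distance depth X − 1 from the first node of its own leg and depth X + 1 from the others.
  depth-from-firsts : ∀ {A B} → A ≢ B → ∀ X → δ X (first A) ⊔ δ X (first B) ≡ suc (depth X)
  depth-from-firsts {A} {B} A≢B X with legView A X | legView B X
  ... | on _ | on _ = contradiction refl A≢B
  ... | on t | off off-B = trans (cong₂ _⊔_ (δ-first-on A t) (δ-first-off X off-B))
                                 (m≤n⇒m⊔n≡n (≤-trans (n≤1+n _) (n≤1+n _)))
  ... | off off-A | on t = trans (cong₂ _⊔_ (δ-first-off X off-A) (δ-first-on B t))
                                 (m≥n⇒m⊔n≡m (≤-trans (n≤1+n _) (n≤1+n _)))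
  ... | off off-A | off off-B =
    trans (cong₂ _⊔_ (δ-first-off X off-A) (δ-first-off X off-B)) (⊔-idem _)

  landmark : Fin M → Vertex
  landmark j = first (suc j)

  on-off-separated : ∀ {l} t Y → (∀ u → Y ≢ node l u) → depth Y ≡ depth (node l t) →
    δ (node l t) (first l) ≢ δ Y (first l)
  on-off-separated {l} t Y off-l depth≡ δ≡ =
    m≢1+n+m (toℕ t) (begin
      toℕ t                  ≡⟨ sym (δ-first-on l t) ⟩
      δ (node l t) (first l) ≡⟨ δ≡ ⟩
      δ Y (first l)          ≡⟨ δ-first-off Y off-l ⟩
      suc (depth Y)          ≡⟨ cong suc depth≡ ⟩
      suc (suc (toℕ t))      ∎)
    where open ≡-Reasoning

  same-depth-separated : ∀ {X Y} → X ≢ Y → depth X ≡ depth Y →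
    Σ (Fin M) λ j → δ X (landmark j) ≢ δ Y (landmark j)
  same-depth-separated {centre} {centre} X≢Y _ = contradiction refl X≢Y
  same-depth-separated {centre} {node _ _} _ ()
  same-depth-separated {node (suc i) t} {Y} X≢Y depth≡ with legView (suc i) Y
  ... | on u = contradiction (cong (node (suc i)) (toℕ-injective (suc-injective depth≡))) X≢Y
  ... | off off-Y = i , on-off-separated t Y off-Y (sym depth≡)
  same-depth-separated {node zero t} {centre} _ ()
  same-depth-separated {node zero t} {node zero u} X≢Y depth≡ =
    contradiction (cong (node zero) (toℕ-injective (suc-injective depth≡))) X≢Y
  same-depth-separated {node zero t} {node (suc j) u} X≢Y depth≡ =
    j , on-off-separated u (node zero t) (λ _ ()) depth≡ ∘ sym

  landmarks-separate : ∀ X Y → X ≢ Y →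
    Σ (Fin M) λ j → δ X (landmark j) ≢ δ Y (landmark j)
  landmarks-separate X Y X≢Y with δ X (landmark zero) ℕ.≟ δ Y (landmark zero)
  ... | no ≢₀ = zero , ≢₀
  ... | yes ≡₀ with δ X (landmark (suc zero)) ℕ.≟ δ Y (landmark (suc zero))
  ...   | no ≢₁ = suc zero , ≢₁
  ...   | yes ≡₁ = same-depth-separated X≢Y (suc-injective (begin
    suc (depth X)                                   ≡⟨ sym (depth-from-firsts 1≢2 X) ⟩
    δ X (landmark zero) ⊔ δ X (landmark (suc zero)) ≡⟨ cong₂ _⊔_ ≡₀ ≡₁ ⟩
    δ Y (landmark zero) ⊔ δ Y (landmark (suc zero)) ≡⟨ depth-from-firsts 1≢2 Y ⟩
    suc (depth Y)                                   ∎))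
    where
    open ≡-Reasoning
    1≢2 : suc zero ≢ suc (suc zero)
    1≢2 ()

  landmarks : Subset k
  landmarks = replicate M true ++ replicate rest false

  ∣prefix∣ : ∀ a b → ∣ replicate a true ++ replicate b false ∣ ≡ a
  ∣prefix∣ zero b = ∣⊥∣≡0 b
  ∣prefix∣ (suc a) b = cong suc (∣prefix∣ a b)

  landmark∈landmarks : ∀ j → enc (landmark j) ∈ landmarks
  landmark∈landmarks j = lookup⇒[]= (j ↑ˡ rest) landmarks
    (trans (lookup-++ˡ (replicate M true) (replicate rest false) j) (lookup-replicate j true))

  landmarks-resolving : Resolving graph landmarks
  landmarks-resolving = separating⇒resolving landmarks λ X Y X≢Y →
    let (j , δ≢δ) = landmarks-separate X Y X≢Y in
    enc (landmark j) , landmark∈landmarks j ,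
    subst (λ Z → δ X Z ≢ δ Y Z) (sym (dec∘enc (landmark j))) δ≢δ

  -- Only a vertex of S on leg l or l′ separates first l from first l′, so S meets all legs but one.
  module _ (S : Subset k) (S-resolving : Resolving graph S) where

    Occupied : Leg → Set
    Occupied l = Σ (Fin (suc (top l))) λ t → enc (node l t) ∈ S

    occupied? : Decidable Occupied
    occupied? l = any? λ t → enc (node l t) ∈? S

    unoccupied⇒off : ∀ {l s} → ¬ Occupied l → s ∈ S → ∀ u → dec s ≢ node l u
    unoccupied⇒off ¬occ s∈S u dec-s≡ = ¬occ (u , subst (_∈ S) (dec≡⇒≡enc dec-s≡) s∈S)

    occupied-pairwise : ∀ l l′ → l ≢ l′ → Occupied l ⊎ Occupied l′
    occupied-pairwise l l′ l≢l′ with occupied? l | occupied? l′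
    ... | yes occ | _ = inj₁ occ
    ... | no _ | yes occ′ = inj₂ occ′
    ... | no ¬occ | no ¬occ′
      with resolving⇒separating S S-resolving (first l) (first l′) (λ { refl → l≢l′ refl })
    ...   | s , s∈S , δ≢δ = contradiction (begin
      δ (first l) (dec s)  ≡⟨ δ-sym (first l) (dec s) ⟩
      δ (dec s) (first l)  ≡⟨ δ-first-off (dec s) (unoccupied⇒off ¬occ s∈S) ⟩
      suc (depth (dec s))  ≡⟨ sym (δ-first-off (dec s) (unoccupied⇒off ¬occ′ s∈S)) ⟩
      δ (dec s) (first l′) ≡⟨ δ-sym (dec s) (first l′) ⟩
      δ (first l′) (dec s) ∎) δ≢δ
      where open ≡-Reasoning

    resolving⇒M≤∣S∣ : M ≤ ∣ S ∣
    resolving⇒M≤∣S∣ with all-but-one occupied? occupied-pairwise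
    ... | h , h-injective , h-occupied =
      injective⇒≤∣p∣ S element element-injective (proj₂ ∘ h-occupied)
      where
      witness : Fin M → Vertex
      witness i = node (h i) (proj₁ (h-occupied i))
      element : Fin M → Fin k
      element = enc ∘ witness
      element-injective : Injective _≡_ _≡_ element
      element-injective {i} {j} e =
        h-injective (node-leg-injective (enc-injective {witness i} {witness j} e))

  metricDim : MetricDim graph M
  metricDim = (landmarks , landmarks-resolving , ∣prefix∣ M rest) , resolving⇒M≤∣S∣

  data OnRay (i : Leg) : Vertex → Set where
    ray-centre : OnRay i centre
    ray-node : ∀ t → OnRay i (node i t)

  OnRay-depth-injective : ∀ {i Y Z} → OnRay i Y → OnRay i Z → depth Y ≡ depth Z → Y ≡ Z
  OnRay-depth-injective ray-centre ray-centre _ = refl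
  OnRay-depth-injective {i} (ray-node t) (ray-node u) e =
    cong (node i) (toℕ-injective (suc-injective e))

  neighbour-of-node : ∀ i t Y → δ (node i t) Y ≡ 1 →
    OnRay i Y × (depth Y ≡ toℕ t ⊎ depth Y ≡ suc (suc (toℕ t)))
  neighbour-of-node i t Y δ≡1 with legView i Y
  ... | on u with ∣m-n∣≡1⇒adjacent (trans (sym (δ-same-leg i t u)) δ≡1)
  ...   | inj₁ 1+u≡t = ray-node u , inj₁ 1+u≡t
  ...   | inj₂ u≡1+t = ray-node u , inj₂ (cong suc u≡1+t)
  neighbour-of-node i t centre δ≡1 | off _ =
    ray-centre , inj₁ (sym (suc-injective (trans (sym (δ-centreʳ (node i t))) δ≡1)))
  neighbour-of-node i t (node j u) δ≡1 | off off-i =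
    contradiction (suc-injective (trans (sym (δ-other-leg (λ { refl → off-i u refl }) t u)) δ≡1))
                  (m+1+n≢0 (toℕ t))

  -- A node has at most two neighbours, one at each adjacent depth on its own ray.
  three-neighbours⇒centre : ∀ {X Y Z W} → δ X Y ≡ 1 → δ X Z ≡ 1 → δ X W ≡ 1 →
    Y ≢ Z → Y ≢ W → Z ≢ W → X ≡ centre
  three-neighbours⇒centre {centre} _ _ _ _ _ _ = refl
  three-neighbours⇒centre {node i t} {Y} {Z} {W} δY δZ δW Y≢Z Y≢W Z≢W
    with neighbour-of-node i t Y δY | neighbour-of-node i t Z δZ | neighbour-of-node i t W δW
  ... | rY , dY | rZ , dZ | rW , dW with two-of-three dY dZ dW
  ...   | inj₁ Y≡Z = contradiction (OnRay-depth-injective rY rZ Y≡Z) Y≢Z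
  ...   | inj₂ (inj₁ Y≡W) = contradiction (OnRay-depth-injective rY rW Y≡W) Y≢W
  ...   | inj₂ (inj₂ Z≡W) = contradiction (OnRay-depth-injective rZ rW Z≡W) Z≢W

  IsTip : Vertex → Set
  IsTip centre = ⊥
  IsTip (node i t) = toℕ t ≡ top i

  tip : Leg → Vertex
  tip i = node i (fromℕ (top i))

  tip-is-tip : ∀ i → IsTip (tip i)
  tip-is-tip i = toℕ-fromℕ (top i)

  tip-has-no-upper-neighbour : ∀ {i t U} → IsTip (node i t) → δ (node i t) U ≡ 1 →
    depth U ≢ suc (suc (toℕ t))
  tip-has-no-upper-neighbour {i} {t} {U} t≡top δ≡1 with neighbour-of-node i t U δ≡1
  ... | ray-centre , _ = λ ()
  ... | ray-node u , _ = λ 1+u≡2+t →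
    1+n≰n (subst (_≤ toℕ t) (suc-injective 1+u≡2+t)
                 (subst (toℕ u ≤_) (sym t≡top) (≤-pred (toℕ<n u))))

  -- A node off leg i is farther from the tip of leg i than any node of leg i.
  determined-by-tip : ∀ {i t Y} → depth Y ≡ depth (node i t) →
    δ Y (tip i) ≡ δ (node i t) (tip i) → Y ≡ node i t
  determined-by-tip {i} {t} {Y} depth≡ δ≡ with legView i Y
  ... | on u = cong (node i) (toℕ-injective (suc-injective depth≡))
  ... | off off-i = contradiction (begin-strict
    top i                               <⟨ m≤n+m (suc (top i)) (depth Y) ⟩
    depth Y + suc (top i)               ≡⟨ cong (λ a → depth Y + suc a) (sym (toℕ-fromℕ (top i))) ⟩
    depth Y + suc (toℕ (fromℕ (top i))) ≡⟨ sym (δ-off-leg Y off-i (fromℕ (top i))) ⟩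
    δ Y (tip i)                         ≡⟨ δ≡ ⟩
    δ (node i t) (tip i)                ≡⟨ δ-same-leg i t (fromℕ (top i)) ⟩
    ∣ toℕ t - toℕ (fromℕ (top i)) ∣     ≡⟨ cong (∣ toℕ t -_∣) (toℕ-fromℕ (top i)) ⟩
    ∣ toℕ t - top i ∣                   ≤⟨ ∣m-n∣≤m⊔n (toℕ t) (top i) ⟩
    toℕ t ⊔ top i                       ≡⟨ m≤n⇒m⊔n≡n (≤-pred (toℕ<n t)) ⟩
    top i                               ∎) (<-irrefl refl)
    where open ≤-Reasoning

  colour : Vertex → Fin (suc p)
  colour centre = zero
  colour (node i _) = toℕ i mod suc p

  -- Legs of equal length are the pendant legs 0 … p, and those are told apart by their colours.
  same-top-and-colour⇒same-leg : ∀ {i j} → top i ≡ top j →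
    toℕ i mod suc p ≡ toℕ j mod suc p → i ≡ j
  same-top-and-colour⇒same-leg {i} {j} top≡ mod≡ = toℕ-injective (∸-%-injective top≡
    (trans (sym (toℕ-fromℕ< _)) (trans (cong toℕ mod≡) (toℕ-fromℕ< _))))

  tips-determined : ∀ {X Y} → IsTip X → IsTip Y →
    depth X ≡ depth Y → colour X ≡ colour Y → X ≡ Y
  tips-determined {node i t} {node j u} t≡top u≡top depth≡ colour≡
    with same-top-and-colour⇒same-leg {i} {j}
           (trans (sym t≡top) (trans (suc-injective depth≡) u≡top)) colour≡
  ... | refl = cong (node i) (toℕ-injective (suc-injective depth≡))

  colouring : Fin k → Fin (suc p)
  colouring = colour ∘ dec

  module Rigidity (f : Automorphism graph)
                  (f-colour : ∀ x → colouring (fun f x) ≡ colouring x) where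

    φ : Vertex → Vertex
    φ = onV f

    φ-injective : Injective _≡_ _≡_ φ
    φ-injective {X} {Y} e =
      trans (sym (onV-inverse (invert f) X))
            (trans (cong (onV (invert f)) e) (onV-inverse (invert f) Y))

    φ-firsts-distinct : ∀ {a b} → a ≢ b → φ (first a) ≢ φ (first b)
    φ-firsts-distinct {a} {b} a≢b e = a≢b (node-leg-injective (φ-injective {first a} {first b} e))

    φ-centre : φ centre ≡ centre
    φ-centre = three-neighbours⇒centre (onV-isometry f centre (first zero))
      (onV-isometry f centre (first (suc zero))) (onV-isometry f centre (first (suc (suc zero))))
      (φ-firsts-distinct {zero} {suc zero} λ ()) (φ-firsts-distinct {zero} {suc (suc zero)} λ ())
      (φ-firsts-distinct {suc zero} {suc (suc zero)} λ ())

    φ-depth : ∀ X → depth (φ X) ≡ depth X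
    φ-depth X = trans (cong (λ C → δ C (φ X)) (sym φ-centre)) (onV-isometry f centre X)

    φ-colour : ∀ X → colour (φ X) ≡ colour X
    φ-colour X = trans (f-colour (enc X)) (cong colour (dec∘enc X))

    -- φ is onto, so an upper neighbour of φ X would pull back to one of X.
    tip-image : ∀ X Y → IsTip X → φ X ≡ Y → IsTip Y
    tip-image (node i t) centre _ φX≡centre
      with trans (sym (cong depth φX≡centre)) (φ-depth (node i t))
    ... | ()
    tip-image X@(node i t) (node j u) X-tip φX≡Y with toℕ u ℕ.≟ top j
    ... | yes u≡top = u≡top
    ... | no u≢top = contradiction depth-V (tip-has-no-upper-neighbour X-tip δ-XV)
      where
      u<top : toℕ u < top j
      u<top = ≤∧≢⇒< (≤-pred (toℕ<n u)) u≢top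
      U V : Vertex
      U = up j u u<top
      V = onV (invert f) U
      δ-XV : δ X V ≡ 1
      δ-XV = begin
        δ X V          ≡⟨ sym (onV-isometry f X V) ⟩
        δ (φ X) (φ V)  ≡⟨ cong₂ δ φX≡Y (onV-inverse f U) ⟩
        δ (node j u) U ≡⟨ δ-up j u u<top ⟩
        1              ∎
        where open ≡-Reasoning
      depth-V : depth V ≡ suc (suc (toℕ t))
      depth-V = begin
        depth V                ≡⟨ sym (φ-depth V) ⟩
        depth (φ V)            ≡⟨ cong depth (onV-inverse f U) ⟩
        depth U                ≡⟨ depth-up j u u<top ⟩
        suc (depth (node j u)) ≡⟨ cong (suc ∘ depth) (sym φX≡Y) ⟩
        suc (depth (φ X))      ≡⟨ cong suc (φ-depth X) ⟩
        suc (suc (toℕ t))      ∎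
        where open ≡-Reasoning

    φ-tip : ∀ X → IsTip X → φ X ≡ X
    φ-tip X X-tip = tips-determined (tip-image X (φ X) X-tip refl) X-tip (φ-depth X) (φ-colour X)

    φ-identity : ∀ X → φ X ≡ X
    φ-identity centre = φ-centre
    φ-identity X@(node i t) = determined-by-tip (φ-depth X) (begin
      δ (φ X) (tip i)     ≡⟨ cong (δ (φ X)) (sym (φ-tip (tip i) (tip-is-tip i))) ⟩
      δ (φ X) (φ (tip i)) ≡⟨ onV-isometry f X (tip i) ⟩
      δ X (tip i)         ∎)
      where open ≡-Reasoning

  colouring-distinguishing : Distinguishing graph colouring
  colouring-distinguishing f f-colour = onV-identity⇒identity f (Rigidity.φ-identity f f-colour)

  module _ (p≤M : p ≤ M) where

    twin : Fin (suc p) → Vertex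
    twin a = first (inject≤ a (s≤s p≤M))

    top-twin : ∀ a → top (inject≤ a (s≤s p≤M)) ≡ 0
    top-twin a =
      trans (cong (_∸ p) (toℕ-inject≤ a (s≤s p≤M))) (m≤n⇒m∸n≡0 (≤-pred (toℕ<n a)))

    δ-twin : ∀ a W → W ≢ twin a → δ (twin a) W ≡ suc (depth W)
    δ-twin a W W≢twin with legView (inject≤ a (s≤s p≤M)) W
    ... | on u = contradiction (cong (node _) (toℕ-injective (n≤0⇒n≡0 u≤0))) W≢twin
      where
      u≤0 : toℕ u ≤ 0
      u≤0 = subst (toℕ u ≤_) (top-twin a) (≤-pred (toℕ<n u))
    ... | off off-leg = trans (δ-sym (twin a) W) (δ-first-off W off-leg)

    twin-injective : Injective _≡_ _≡_ twin
    twin-injective {a} {b} e = inject≤-injective _ _ a b (node-leg-injective e)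

    distinguishing⇒1+p≤ : ∀ r (c : Fin k → Fin r) → Distinguishing graph c → suc p ≤ r
    distinguishing⇒1+p≤ r c c-distinguishing =
      injective⇒≤ {f = c ∘ enc ∘ twin} λ {a} {b} c≡c → decidable-stable (a ≟ b) λ a≢b →
        twins⇒colours-differ (a≢b ∘ twin-injective) (twins a b) c c-distinguishing c≡c
      where
      twins : ∀ a b W → W ≢ twin a → W ≢ twin b → δ (twin a) W ≡ δ (twin b) W
      twins a b W W≢a W≢b = trans (δ-twin a W W≢a) (sym (δ-twin b W W≢b))

    distNum : DistNum graph (suc p)
    distNum = (colouring , colouring-distinguishing) , distinguishing⇒1+p≤

mainTheorem4 : ∀ (n m : ℕ) → 1 ≤ n → n < m →
    Σ ℕ λ k → Σ (Graph k) λ G → Connected G × DistNum G n × MetricDim G m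
mainTheorem4 (suc p) (suc (suc M′)) (s≤s z≤n) (s≤s (s≤s p≤M′)) =
  k , graph , connected , distNum (≤-trans p≤M′ (m≤n+m M′ 2)) , metricDim
  where open Spider p M′
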